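{- Let $G$ and $H$ be two graphs of orders $n$ and $m$, respectively. Then $D'(G+H)\leq D'(K_{n,m})+1$.
   Context: The join $G+H$ of graphs on disjoint vertex sets has as edges all edges of $G$, all edges of $H$, and all pairs with one end in $V(G)$ and the other in $V(H)$. $K_{n,m}$ is the complete bipartite graph with parts of sizes $n$ and $m$. The distinguishing index $D'(X)$ of a graph $X$ is the least $d$ such that $X$ has an edge colouring with $d$ colours preserved by no non-identity automorphism of $X$. -}

module Defs where

open import Data.Nat using (ℕ; _+_; _<_; _≤_)
open import Data.Bool using (Bool; true; false; T; _∧_)
open import Data.Fin using (Fin; splitAt)
open import Data.Fin.Permutation using (Permutation′; _⟨$⟩ʳ_)
open import Data.Sum using (_⊎_; inj₁; inj₂)
open import Data.Product using (Σ; _×_)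
open import Relation.Binary.PropositionalEquality using (_≡_)
open import Relation.Nullary using (¬_)

record Graph (n : ℕ) : Set where
  field
    adj     : Fin n → Fin n → Bool
    adj-sym : ∀ u v → adj u v ≡ adj v u
    loopless : ∀ u → adj u u ≡ false
open Graph public

Edge : ∀ {n} → Graph n → Fin n → Fin n → Set
Edge X u v = T (adj X u v)

joinAdj : ∀ {n m} → Graph n → Graph m → Fin (n + m) → Fin (n + m) → Bool
joinAdj {n} {m} G H u v with splitAt n u | splitAt n v
... | inj₁ a | inj₁ b = adj G a b
... | inj₂ a | inj₂ b = adj H a b
... | inj₁ _ | inj₂ _ = true
... | inj₂ _ | inj₁ _ = true

private
  joinAdj-sym : ∀ {n m} (G : Graph n) (H : Graph m) u v →
                joinAdj G H u v ≡ joinAdj G H v u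
  joinAdj-sym {n} G H u v with splitAt n u | splitAt n v
  ... | inj₁ a | inj₁ b = adj-sym G a b
  ... | inj₂ a | inj₂ b = adj-sym H a b
  ... | inj₁ _ | inj₂ _ = Relation.Binary.PropositionalEquality.refl
  ... | inj₂ _ | inj₁ _ = Relation.Binary.PropositionalEquality.refl

  joinAdj-loop : ∀ {n m} (G : Graph n) (H : Graph m) u → joinAdj G H u u ≡ false
  joinAdj-loop {n} G H u with splitAt n u
  ... | inj₁ a = loopless G a
  ... | inj₂ a = loopless H a

_⊕_ : ∀ {n m} → Graph n → Graph m → Graph (n + m)
G ⊕ H = record { adj = joinAdj G H ; adj-sym = joinAdj-sym G H ; loopless = joinAdj-loop G H }

Empty : (n : ℕ) → Graph n
Empty n = record { adj = λ _ _ → false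
                 ; adj-sym = λ _ _ → Relation.Binary.PropositionalEquality.refl
                 ; loopless = λ _ → Relation.Binary.PropositionalEquality.refl }

K : (n m : ℕ) → Graph (n + m)
K n m = Empty n ⊕ Empty m

IsAut : ∀ {n} → Graph n → Permutation′ n → Set
IsAut X σ = ∀ u v → adj X (σ ⟨$⟩ʳ u) (σ ⟨$⟩ʳ v) ≡ adj X u v

record EdgeColouring {n} (X : Graph n) (d : ℕ) : Set where
  field
    col : ∀ u v → Edge X u v → Fin d
    col-sym : ∀ u v (e : Edge X u v) (e′ : Edge X v u) → col u v e ≡ col v u e′
open EdgeColouring public

Preserves : ∀ {n} {X : Graph n} {d} → EdgeColouring X d → Permutation′ n → Set
Preserves {X = X} c σ =
  ∀ u v (e : Edge X u v) (e′ : Edge X (σ ⟨$⟩ʳ u) (σ ⟨$⟩ʳ v)) →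
    col c (σ ⟨$⟩ʳ u) (σ ⟨$⟩ʳ v) e′ ≡ col c u v e

Distinguishing : ∀ {n} {X : Graph n} {d} → EdgeColouring X d → Set
Distinguishing {n} {X} c =
  ∀ (σ : Permutation′ n) → IsAut X σ → Preserves c σ → ∀ u → σ ⟨$⟩ʳ u ≡ u

HasDistColouring : ∀ {n} → Graph n → ℕ → Set
HasDistColouring X d = Σ (EdgeColouring X d) Distinguishing

IsDistIndex : ∀ {n} → Graph n → ℕ → Set
IsDistIndex X d = HasDistColouring X d × (∀ d′ → d′ < d → ¬ HasDistColouring X d′)

-- The cross edges of G + H form a spanning copy of K_{n,m}. Colour them by a
-- distinguishing colouring of K_{n,m} and give every edge inside G or H one
-- new colour. An automorphism of G + H preserving this colouring must map
-- cross edges to cross edges and non-cross edges to non-cross edges, so it is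
-- an automorphism of K_{n,m} preserving the old colouring, hence the identity.
-- Existence of a distinguishing colouring with d colours is decidable by
-- exhaustive search, so the least such d exists and is at most D'(K_{n,m}) + 1.
module Submission where

open import Defs
open import Data.Nat using (ℕ; zero; suc; _≤_; _<_; _+_)
open import Data.Nat.Properties
  using (≤-trans; ≤-reflexive; +-comm; n<1+n; m<n⇒m<1+n; m<1+n⇒m<n∨m≡n; m<1+n⇒m≤n)
open import Data.Bool using (true; false; T)
open import Data.Bool.Properties using (T?; T-irrelevant) renaming (_≟_ to _≟ᴮ_)
open import Data.Empty using (⊥-elim)
open import Data.Fin using (Fin; zero; _≟_; fromℕ; inject₁; splitAt; finToFun; funToFin)
open import Data.Fin.Properties
  using (any?; all?; ¬Fin0; fromℕ≢inject₁; inject₁-injective; finToFun-funToFin)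
open import Data.Fin.Permutation using (Permutation′; _⟨$⟩ʳ_; _⟨$⟩ˡ_; permutation; inverseˡ; inverseʳ)
open import Data.Product using (Σ; ∃; _×_; _,_; proj₁; proj₂)
open import Data.Sum using (inj₁; inj₂; _⊎_; [_,_])
open import Data.Unit using (tt)
open import Function using (_∘_)
open import Relation.Binary.PropositionalEquality
  using (_≡_; _≢_; _≗_; refl; sym; trans; cong; subst; subst₂; module ≡-Reasoning)
open import Relation.Nullary using (¬_; Dec; yes; no; ¬?; _×-dec_; contradiction)
open import Relation.Nullary.Decidable using (map′; decidable-stable)

private
  variable
    n k d : ℕ

IsLeast : (ℕ → Set) → ℕ → Set
IsLeast P d = P d × (∀ j → j < d → ¬ P j)

module _ {P : ℕ → Set} (P? : ∀ i → Dec (P i)) where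

  none-below-or-least : ∀ k → (∀ j → j < k → ¬ P j) ⊎ ∃ λ d → d < k × IsLeast P d
  none-below-or-least zero = inj₁ λ _ ()
  none-below-or-least (suc k) with none-below-or-least k
  ... | inj₂ (d , d<k , least) = inj₂ (d , m<n⇒m<1+n d<k , least)
  ... | inj₁ none with P? k
  ...   | yes pk = inj₂ (k , n<1+n k , pk , none)
  ...   | no ¬pk = inj₁ λ j j<1+k → [ none j , (λ { refl → ¬pk }) ] (m<1+n⇒m<n∨m≡n j<1+k)

  least-witness : ∀ {k} → P k → ∃ λ d → d ≤ k × IsLeast P d
  least-witness {k} pk with none-below-or-least (suc k)
  ... | inj₁ none                = contradiction pk (none k (n<1+n k))
  ... | inj₂ (d , d<1+k , least) = d , m<1+n⇒m≤n d<1+k , least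

all-T? : ∀ b {P : T b → Set} → (∀ e → Dec (P e)) → Dec (∀ e → P e)
all-T? false P? = yes λ ()
all-T? true  P? = map′ (λ p _ → p) (λ p → p tt) (P? tt)

T-injective : ∀ {a b} → (T a → T b) → (T b → T a) → a ≡ b
T-injective {false} {false} _ _ = refl
T-injective {false} {true}  _ g = ⊥-elim (g tt)
T-injective {true}  {false} f _ = ⊥-elim (f tt)
T-injective {true}  {true}  _ _ = refl

-- Without function extensionality the searched predicates must respect
-- pointwise equality, since Fin (k ^ n) only encodes functions up to _≗_.
any-fun? : {P : (Fin n → Fin k) → Set} → (∀ {f g} → f ≗ g → P f → P g) →
           (∀ f → Dec (P f)) → Dec (∃ P)
any-fun? resp P? =
  map′ (λ (i , p) → finToFun i , p)
       (λ (f , p) → funToFin f , resp (sym ∘ finToFun-funToFin f) p)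
       (any? (P? ∘ finToFun))

any-fun²? : {P : (Fin n → Fin n → Fin k) → Set} →
            (∀ {f g} → (∀ u v → f u v ≡ g u v) → P f → P g) →
            (∀ f → Dec (P f)) → Dec (∃ P)
any-fun²? resp P? =
  map′ (λ (f̂ , p) → finToFun ∘ f̂ , p)
       (λ (f , p) → funToFin ∘ f , resp (λ u v → sym (finToFun-funToFin (f u) v)) p)
       (any-fun? (λ f̂≗ĝ → resp (λ u v → cong (λ i → finToFun i v) (f̂≗ĝ u)))
                 (P? ∘ (finToFun ∘_)))

any-permutation? : {P : Permutation′ n → Set} →
                   (∀ {σ τ} → (σ ⟨$⟩ʳ_) ≗ (τ ⟨$⟩ʳ_) → P σ → P τ) →
                   (∀ σ → Dec (P σ)) → Dec (∃ P)
any-permutation? {n} {P} resp P? =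
  map′ (λ (f , g , l , r , p) → permutation f g l r , p)
       (λ (σ , p) → (σ ⟨$⟩ʳ_) , (σ ⟨$⟩ˡ_) , (λ _ → inverseʳ σ) , (λ _ → inverseˡ σ) , resp (λ _ → refl) p)
       (any-fun? resp-f λ f → any-fun? (resp-g f) (Witness? f))
  where
  Witness : (f g : Fin n → Fin n) → Set
  Witness f g = Σ (∀ y → f (g y) ≡ y) λ l → Σ (∀ x → g (f x) ≡ x) λ r → P (permutation f g l r)

  Witness? : ∀ f g → Dec (Witness f g)
  Witness? f g with all? (λ y → f (g y) ≟ y) | all? (λ x → g (f x) ≟ x)
  ... | no ¬l | _     = no (¬l ∘ proj₁)
  ... | yes _ | no ¬r = no (¬r ∘ proj₁ ∘ proj₂)
  ... | yes l | yes r = map′ (λ p → l , r , p) (λ (_ , _ , p) → resp (λ _ → refl) p)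
                             (P? (permutation f g l r))

  resp-g : ∀ f {g g′} → g ≗ g′ → Witness f g → Witness f g′
  resp-g f g≗g′ (l , r , p) =
    (λ y → trans (cong f (sym (g≗g′ y))) (l y)) , (λ x → trans (sym (g≗g′ (f x))) (r x)) ,
    resp (λ _ → refl) p

  resp-f : ∀ {f f′} → f ≗ f′ → ∃ (Witness f) → ∃ (Witness f′)
  resp-f f≗f′ (g , l , r , p) =
    g , (λ y → trans (sym (f≗f′ (g y))) (l y)) , (λ x → trans (cong g (sym (f≗f′ x))) (r x)) ,
    resp f≗f′ p

module _ (X : Graph n) where

  Edge-sym : ∀ {u v} → Edge X u v → Edge X v u
  Edge-sym {u} {v} = subst T (adj-sym X u v)

  preserves-resp : (c c′ : EdgeColouring X d) →
                   (∀ u v e → col c u v e ≡ col c′ u v e) →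
                   ∀ σ → Preserves c σ → Preserves c′ σ
  preserves-resp c c′ c≗c′ σ p u v e e′ = trans (sym (c≗c′ _ _ e′)) (trans (p u v e e′) (c≗c′ u v e))

  distinguishing-resp : (c c′ : EdgeColouring X d) →
                        (∀ u v e → col c u v e ≡ col c′ u v e) →
                        Distinguishing c → Distinguishing c′
  distinguishing-resp c c′ c≗c′ D σ a p =
    D σ a (preserves-resp c′ c (λ u v e → sym (c≗c′ u v e)) σ p)

  isAut? : ∀ σ → Dec (IsAut X σ)
  isAut? σ = all? λ u → all? λ v → adj X (σ ⟨$⟩ʳ u) (σ ⟨$⟩ʳ v) ≟ᴮ adj X u v

  preserves? : (c : EdgeColouring X d) → ∀ σ → Dec (Preserves c σ)
  preserves? c σ = all? λ u → all? λ v → all-T? (adj X u v) λ e →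
    all-T? (adj X (σ ⟨$⟩ʳ u) (σ ⟨$⟩ʳ v)) λ e′ → col c _ _ e′ ≟ col c u v e

  NontrivialPreservingAut : EdgeColouring X d → Permutation′ n → Set
  NontrivialPreservingAut c σ = IsAut X σ × Preserves c σ × ∃ λ u → σ ⟨$⟩ʳ u ≢ u

  nontrivialPreservingAut-resp : (c : EdgeColouring X d) → ∀ {σ τ} → (σ ⟨$⟩ʳ_) ≗ (τ ⟨$⟩ʳ_) →
                                 NontrivialPreservingAut c σ → NontrivialPreservingAut c τ
  nontrivialPreservingAut-resp c {σ} {τ} σ≗τ (a , p , u , σu≢u) =
    pairwise (λ u v x y → adj X x y ≡ adj X u v) a ,
    pairwise (λ u v x y → ∀ e (e′ : Edge X x y) → col c x y e′ ≡ col c u v e) p ,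
    u , σu≢u ∘ trans (σ≗τ u)
    where
    pairwise : (R : (u v x y : Fin n) → Set) →
               (∀ u v → R u v (σ ⟨$⟩ʳ u) (σ ⟨$⟩ʳ v)) → ∀ u v → R u v (τ ⟨$⟩ʳ u) (τ ⟨$⟩ʳ v)
    pairwise R h u v = subst₂ (R u v) (σ≗τ u) (σ≗τ v) (h u v)

  distinguishing? : (c : EdgeColouring X d) → Dec (Distinguishing c)
  distinguishing? c =
    map′ (λ none σ a p u → decidable-stable (σ ⟨$⟩ʳ u ≟ u) λ σu≢u → none (σ , a , p , u , σu≢u))
         (λ D (σ , a , p , u , σu≢u) → σu≢u (D σ a p u))
         (¬? (any-permutation? (λ {σ} {τ} → nontrivialPreservingAut-resp c {σ} {τ}) λ σ →
                isAut? σ ×-dec preserves? c σ ×-dec any? (λ u → ¬? (σ ⟨$⟩ʳ u ≟ u))))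

  EdgeSymmetric : (Fin n → Fin n → Fin d) → Set
  EdgeSymmetric κ = ∀ u v → Edge X u v → κ u v ≡ κ v u

  edgeSymmetric? : (κ : Fin n → Fin n → Fin d) → Dec (EdgeSymmetric κ)
  edgeSymmetric? κ = all? λ u → all? λ v → all-T? (adj X u v) λ _ → κ u v ≟ κ v u

  fromSymmetric : (κ : Fin n → Fin n → Fin d) → EdgeSymmetric κ → EdgeColouring X d
  fromSymmetric κ s = record { col = λ u v _ → κ u v ; col-sym = λ u v e _ → s u v e }

  DistinguishingSymmetric : (Fin n → Fin n → Fin d) → Set
  DistinguishingSymmetric κ = Σ (EdgeSymmetric κ) (Distinguishing ∘ fromSymmetric κ)

  distinguishingSymmetric? : (κ : Fin n → Fin n → Fin d) → Dec (DistinguishingSymmetric κ)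
  distinguishingSymmetric? κ with edgeSymmetric? κ
  ... | no ¬s = no (¬s ∘ proj₁)
  ... | yes s = map′ (s ,_)
    (λ (s′ , D) → distinguishing-resp (fromSymmetric κ s′) (fromSymmetric κ s) (λ _ _ _ → refl) D)
    (distinguishing? (fromSymmetric κ s))

  distinguishingSymmetric-resp : ∀ {κ κ′ : Fin n → Fin n → Fin d} → (∀ u v → κ u v ≡ κ′ u v) →
                                 DistinguishingSymmetric κ → DistinguishingSymmetric κ′
  distinguishingSymmetric-resp {κ = κ} κ≗κ′ (s , D) =
    s′ , distinguishing-resp (fromSymmetric κ s) (fromSymmetric _ s′) (λ u v _ → κ≗κ′ u v) D
    where
    s′ : EdgeSymmetric _
    s′ u v e = trans (sym (κ≗κ′ u v)) (trans (s u v e) (κ≗κ′ v u))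

  colourOr : EdgeColouring X d → Fin d → Fin n → Fin n → Fin d
  colourOr c default u v with T? (adj X u v)
  ... | yes e = col c u v e
  ... | no _  = default

  colourOr-edge : (c : EdgeColouring X d) (default : Fin d) →
                  ∀ {u v} (e : Edge X u v) → colourOr c default u v ≡ col c u v e
  colourOr-edge c default {u} {v} e with T? (adj X u v)
  ... | yes e′ = cong (col c u v) (T-irrelevant e′ e)
  ... | no ¬e  = contradiction e ¬e

  colourOr-symmetric : (c : EdgeColouring X d) (default : Fin d) → EdgeSymmetric (colourOr c default)
  colourOr-symmetric c default u v e = begin
    colourOr c default u v  ≡⟨ colourOr-edge c default e ⟩
    col c u v e             ≡⟨ col-sym c u v e (Edge-sym e) ⟩
    col c v u (Edge-sym e)  ≡⟨ colourOr-edge c default (Edge-sym e) ⟨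
    colourOr c default v u  ∎
    where open ≡-Reasoning

  -- Colourings are searched as total functions on vertex pairs, which needs a
  -- default colour for non-edges; with no colours X must be edgeless instead.
  hasDistColouring? : ∀ d → Dec (HasDistColouring X d)
  hasDistColouring? zero with all? (λ u → all? λ v → ¬? (T? (adj X u v)))
  ... | no ¬edgeless = no λ (c , _) → ¬edgeless λ u v e → ¬Fin0 (col c u v e)
  ... | yes edgeless =
    map′ (c₀ ,_) (λ (c , D) → distinguishing-resp c c₀ (λ u v e → ⊥-elim (edgeless u v e)) D)
         (distinguishing? c₀)
    where
    c₀ : EdgeColouring X 0
    c₀ = record { col     = λ u v e → ⊥-elim (edgeless u v e)
                ; col-sym = λ u v e _ → ⊥-elim (edgeless u v e) }
  hasDistColouring? (suc d) =
    map′ (λ (κ , s , D) → fromSymmetric κ s , D)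
         (λ (c , D) → colourOr c zero , colourOr-symmetric c zero ,
                      distinguishing-resp c (fromSymmetric _ (colourOr-symmetric c zero))
                                          (λ u v e → sym (colourOr-edge c zero e)) D)
         (any-fun²? distinguishingSymmetric-resp distinguishingSymmetric?)

SpanningSubgraph : Graph n → Graph n → Set
SpanningSubgraph Y X = ∀ u v → Edge Y u v → Edge X u v

module _ {Y : Graph n} {X : Graph n} (Y⊆X : SpanningSubgraph Y X) (c : EdgeColouring Y d) where

  colour⁺ : Fin n → Fin n → Fin (suc d)
  colour⁺ u v with T? (adj Y u v)
  ... | yes y = inject₁ (col c u v y)
  ... | no _  = fromℕ d

  colour⁺-∈ : ∀ {u v} (y : Edge Y u v) → colour⁺ u v ≡ inject₁ (col c u v y)
  colour⁺-∈ {u} {v} y with T? (adj Y u v)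
  ... | yes y′ = cong (inject₁ ∘ col c u v) (T-irrelevant y′ y)
  ... | no ¬y  = contradiction y ¬y

  colour⁺-∉ : ∀ {u v} → ¬ Edge Y u v → colour⁺ u v ≡ fromℕ d
  colour⁺-∉ {u} {v} ¬y with T? (adj Y u v)
  ... | yes y = contradiction y ¬y
  ... | no _  = refl

  colour⁺-reflects-Edge : ∀ {u v u′ v′} → colour⁺ u v ≡ colour⁺ u′ v′ → Edge Y u v → Edge Y u′ v′
  colour⁺-reflects-Edge {u′ = u′} {v′} eq y = decidable-stable (T? (adj Y u′ v′)) λ ¬y′ →
    fromℕ≢inject₁ (trans (sym (colour⁺-∉ ¬y′)) (trans (sym eq) (colour⁺-∈ y)))

  colour⁺-sym : ∀ u v → colour⁺ u v ≡ colour⁺ v u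
  colour⁺-sym u v with T? (adj Y u v)
  ... | yes y = trans (cong inject₁ (col-sym c u v y (Edge-sym Y y)))
                      (sym (colour⁺-∈ (Edge-sym Y y)))
  ... | no ¬y = sym (colour⁺-∉ (¬y ∘ Edge-sym Y))

  colouring⁺ : EdgeColouring X (suc d)
  colouring⁺ = record { col = λ u v _ → colour⁺ u v ; col-sym = λ u v _ _ → colour⁺-sym u v }

  module _ (σ : Permutation′ n) (a : IsAut X σ) (p : Preserves colouring⁺ σ) where

    private
      s : Fin n → Fin n
      s = σ ⟨$⟩ʳ_

    Edge-aut : ∀ {u v} → Edge X u v → Edge X (s u) (s v)
    Edge-aut {u} {v} = subst T (sym (a u v))

    Edge-image : ∀ {u v} → Edge Y u v → Edge Y (s u) (s v)
    Edge-image {u} {v} y = colour⁺-reflects-Edge (sym (p u v e (Edge-aut e))) y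
      where e = Y⊆X u v y

    Edge-preimage : ∀ {u v} → Edge Y (s u) (s v) → Edge Y u v
    Edge-preimage {u} {v} y′ = colour⁺-reflects-Edge (p u v (subst T (a u v) e′) e′) y′
      where e′ = Y⊆X (s u) (s v) y′

    isAut-subgraph : IsAut Y σ
    isAut-subgraph u v = T-injective Edge-preimage Edge-image

    preserves-subgraph : Preserves c σ
    preserves-subgraph u v y y′ = inject₁-injective (begin
      inject₁ (col c (s u) (s v) y′) ≡⟨ colour⁺-∈ y′ ⟨
      colour⁺ (s u) (s v)            ≡⟨ p u v e (Edge-aut e) ⟩
      colour⁺ u v                    ≡⟨ colour⁺-∈ y ⟩
      inject₁ (col c u v y)          ∎)
      where
      open ≡-Reasoning
      e = Y⊆X u v y

hasDistColouring-suc : {Y X : Graph n} → SpanningSubgraph Y X →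
                       HasDistColouring Y d → HasDistColouring X (suc d)
hasDistColouring-suc {Y = Y} {X} Y⊆X (c , D) = colouring⁺ Y⊆X c , λ σ a p →
  D σ (isAut-subgraph {Y = Y} {X} Y⊆X c σ a p) (preserves-subgraph {Y = Y} {X} Y⊆X c σ a p)

K-⊆-⊕ : ∀ {n m} (G : Graph n) (H : Graph m) → SpanningSubgraph (K n m) (G ⊕ H)
K-⊆-⊕ {n} G H u v k with splitAt n u | splitAt n v
... | inj₁ _ | inj₂ _ = tt
... | inj₂ _ | inj₁ _ = tt

theorem3p3 : ∀ {n m : ℕ} (G : Graph n) (H : Graph m) (d : ℕ) →
    IsDistIndex (K n m) d →
    Σ ℕ (λ d′ → IsDistIndex (G ⊕ H) d′ × d′ ≤ d + 1)
theorem3p3 G H d (distK , _)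
  with least-witness (hasDistColouring? (G ⊕ H)) (hasDistColouring-suc (K-⊆-⊕ G H) distK)
... | d′ , d′≤1+d , least = d′ , least , ≤-trans d′≤1+d (≤-reflexive (+-comm 1 d))
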